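{- If $e$ is an element of a matroid $M$, then at least one of $K(M\backslash e)$ and $K(M/e)$ adheres to $K(M)$.
   Context: For a matroid $M$ with rank function $r$ and ground set $E$, $\lambda_M(X)=r(X)+r(E\setminus X)-r(M)+1$ for $X\subseteq E$, and $K(M)=(E(M),\lambda_M)$. For pairs $K=(E,\lambda)$ and $K_0=(E_0,\lambda_0)$ of this kind, $K$ dominates $K_0$ if $E_0\subseteq E$ and $\lambda_0(X)\le\lambda(X)$ for all $X\subseteq E_0$; and $K_0$ adheres to $K$ if $K$ dominates $K_0$ and for each partition $(A,B)$ of $E_0$ there is a partition $(X_1,X_2)$ of $A$ or of $B$ (one of $X_1,X_2$ may be empty) with $\lambda(X_1)\le\lambda_0(A)$ and $\lambda(X_2)\le\lambda_0(A)$. -}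

module Defs where

open import Data.Nat using (ℕ; _+_; _∸_; _≤_)
open import Data.Fin using (Fin)
open import Data.Fin.Subset using (Subset; _⊆_; _∪_; _∩_; _─_; ⁅_⁆; ∣_∣; ⊤; ⊥)
open import Data.Product using (Σ; _×_; ∃₂)
open import Data.Sum using (_⊎_)
open import Relation.Binary.PropositionalEquality using (_≡_)

record Matroid (n : ℕ) : Set where
  field
    r         : Subset n → ℕ
    r-bounded : ∀ X → r X ≤ ∣ X ∣
    r-mono    : ∀ {X Y} → X ⊆ Y → r X ≤ r Y
    r-submod  : ∀ X Y → r (X ∪ Y) + r (X ∩ Y) ≤ r X + r Y
open Matroid public

-- A pair K = (E , λ) with E a subset of the universe Fin n and λ defined on
-- subsets (only its values on subsets of E matter).
record KPair (n : ℕ) : Set where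
  constructor kpair
  field
    gnd : Subset n
    lam : Subset n → ℕ
open KPair public

-- Connectivity function of a matroid with ground set E and rank function r:
-- λ(X) = r(X) + r(E \ X) - r(E) + 1   (exact in ℕ by submodularity).
connectivity : ∀ {n} → Subset n → (Subset n → ℕ) → Subset n → ℕ
connectivity E rk X = (rk X + rk (E ─ X) + 1) ∸ rk E

K : ∀ {n} → Matroid n → KPair n
K M = kpair ⊤ (connectivity ⊤ (r M))

deleteRank : ∀ {n} → Matroid n → Fin n → Subset n → ℕ
deleteRank M e X = r M X

contractRank : ∀ {n} → Matroid n → Fin n → Subset n → ℕ
contractRank M e X = r M (X ∪ ⁅ e ⁆) ∸ r M ⁅ e ⁆

K-delete : ∀ {n} → Matroid n → Fin n → KPair n
K-delete M e = kpair (⊤ ─ ⁅ e ⁆) (connectivity (⊤ ─ ⁅ e ⁆) (deleteRank M e))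

K-contract : ∀ {n} → Matroid n → Fin n → KPair n
K-contract M e = kpair (⊤ ─ ⁅ e ⁆) (connectivity (⊤ ─ ⁅ e ⁆) (contractRank M e))

-- (X₁ , X₂) is a partition of A (parts may be empty).
IsPartition : ∀ {n} → Subset n → Subset n → Subset n → Set
IsPartition A X₁ X₂ = (X₁ ∪ X₂ ≡ A) × (X₁ ∩ X₂ ≡ ⊥)

Dominates : ∀ {n} → KPair n → KPair n → Set
Dominates K K₀ = (gnd K₀ ⊆ gnd K) × (∀ X → X ⊆ gnd K₀ → lam K₀ X ≤ lam K X)

-- K₀ adheres to K.  A partition (A , B) of E₀ is given by A ⊆ E₀, B = E₀ - A.
Adheres : ∀ {n} → KPair n → KPair n → Set
Adheres K₀ K =
  Dominates K K₀ ×
  (∀ A → A ⊆ gnd K₀ →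
     ∃₂ λ X₁ X₂ →
       (IsPartition A X₁ X₂ ⊎ IsPartition (gnd K₀ ─ A) X₁ X₂) ×
       (lam K X₁ ≤ lam K₀ A) × (lam K X₂ ≤ lam K₀ A))

module Submission where

-- Suppose K(M\e) does not adhere, and fix A ⊆ E − e with no partition good for λ_{M\e}(A);
-- write B = (E − e) − A.  Given C ⊆ E − e with complement D, if C (or D) does not span e then
-- λ_M(C) ≤ λ_{M/e}(C), so the trivial partition of C (or D) is good.  Otherwise e lies in the
-- closure of both C and D, and submodularity on the cells gives
--   λ_M(A ∩ C) + λ_M(B ∩ D) ≤ λ_{M\e}(A) + λ_{M/e}(C) + 1,
-- and the same for the other diagonal.  Neither row {A ∩ C, A ∩ D}, {B ∩ C, B ∩ D} is bounded
-- by λ_{M\e}(A), as it would partition A or B; hence some column is bounded by λ_{M/e}(C),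
-- and it partitions C or D.

open import Defs
open import Data.Bool using (Bool; true; false; _∧_; _∨_; not; T) renaming (_≟_ to _≟ᵇ_)
open import Data.Bool.Properties using (T-≡; T-∧; ∧-identityʳ)
open import Data.Fin using (Fin; zero; suc)
open import Data.Fin.Subset using (Subset; _∈_; _⊆_; _∪_; _∩_; _─_; ⁅_⁆; ∣_∣; ⊤; ⊥)
open import Data.Fin.Subset.Properties
  using (⊆⊤; ⊆-refl; ⊆-antisym; _⊆?_; p⊆p∪q; q⊆p∪q; p─q⊆p; p─⊥≡p; ∪-identityʳ; ∩-zeroʳ;
         ∣⊥∣≡0; ∣⁅x⁆∣≡1; anySubset?)
open import Data.List using (List; []; _∷_)
open import Data.Nat using (ℕ; zero; suc; _+_; _∸_; _≤_; _<_; _≤?_)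
open import Data.Nat.Properties
open import Algebra.Properties.CommutativeSemigroup +-commutativeSemigroup using (interchange)
open import Data.Nat.Tactic.RingSolver using (solve-∀)
open import Data.Product using (_×_; _,_; proj₁; proj₂; ∃; ∃₂)
open import Data.Sum using (_⊎_; inj₁; inj₂; [_,_]; swap)
open import Data.Unit using (tt) renaming (⊤ to Unit)
open import Data.Vec using (Vec; []; _∷_; lookup; map)
open import Data.Vec.Properties using (lookup-zipWith; lookup-replicate; lookup-map; []=⇒lookup; lookup⇒[]=; ≡-dec)
open import Function using (_∘_; Equivalence)
open import Relation.Binary.PropositionalEquality hiding ([_])
open import Relation.Nullary using (¬_; Dec; yes; no; contradiction)
open import Relation.Nullary.Decidable using (_×-dec_; _⊎-dec_; ¬?; decidable-stable)

-- Boolean set algebra by truth tables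

infixr 7 _∩ᶠ_
infixr 6 _∪ᶠ_
infixl 5 _─ᶠ_

data SetExpr (k : ℕ) : Set where
  var            : Fin k → SetExpr k
  ⊤ᶠ ⊥ᶠ          : SetExpr k
  _∪ᶠ_ _∩ᶠ_ _─ᶠ_ : SetExpr k → SetExpr k → SetExpr k

x₀ : ∀ {k} → SetExpr (suc k)
x₀ = var zero

x₁ : ∀ {k} → SetExpr (suc (suc k))
x₁ = var (suc zero)

x₂ : ∀ {k} → SetExpr (suc (suc (suc k)))
x₂ = var (suc (suc zero))

⟦_⟧ : ∀ {k n} → SetExpr k → Vec (Subset n) k → Subset n
⟦ var i ⟧  σ = lookup σ i
⟦ ⊤ᶠ ⟧     σ = ⊤
⟦ ⊥ᶠ ⟧     σ = ⊥
⟦ s ∪ᶠ t ⟧ σ = ⟦ s ⟧ σ ∪ ⟦ t ⟧ σ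
⟦ s ∩ᶠ t ⟧ σ = ⟦ s ⟧ σ ∩ ⟦ t ⟧ σ
⟦ s ─ᶠ t ⟧ σ = ⟦ s ⟧ σ ─ ⟦ t ⟧ σ

⟦_⟧ᵇ : ∀ {k} → SetExpr k → Vec Bool k → Bool
⟦ var i ⟧ᵇ  β = lookup β i
⟦ ⊤ᶠ ⟧ᵇ     β = true
⟦ ⊥ᶠ ⟧ᵇ     β = false
⟦ s ∪ᶠ t ⟧ᵇ β = ⟦ s ⟧ᵇ β ∨ ⟦ t ⟧ᵇ β
⟦ s ∩ᶠ t ⟧ᵇ β = ⟦ s ⟧ᵇ β ∧ ⟦ t ⟧ᵇ β
⟦ s ─ᶠ t ⟧ᵇ β = ⟦ s ⟧ᵇ β ∧ not (⟦ t ⟧ᵇ β)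

lookup-─ : ∀ {n} (p q : Subset n) x → lookup (p ─ q) x ≡ lookup p x ∧ not (lookup q x)
lookup-─ (false ∷ p) (true  ∷ q) zero    = refl
lookup-─ (true  ∷ p) (true  ∷ q) zero    = refl
lookup-─ (b     ∷ p) (false ∷ q) zero    = sym (∧-identityʳ b)
lookup-─ (_     ∷ p) (_     ∷ q) (suc x) = lookup-─ p q x

lookup-⟦⟧ : ∀ {k n} (s : SetExpr k) (σ : Vec (Subset n) k) x →
            lookup (⟦ s ⟧ σ) x ≡ ⟦ s ⟧ᵇ (map (λ p → lookup p x) σ)
lookup-⟦⟧ (var i)  σ x = sym (lookup-map i (λ p → lookup p x) σ)
lookup-⟦⟧ ⊤ᶠ       σ x = lookup-replicate x true
lookup-⟦⟧ ⊥ᶠ       σ x = lookup-replicate x false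
lookup-⟦⟧ (s ∪ᶠ t) σ x =
  trans (lookup-zipWith _∨_ x (⟦ s ⟧ σ) (⟦ t ⟧ σ)) (cong₂ _∨_ (lookup-⟦⟧ s σ x) (lookup-⟦⟧ t σ x))
lookup-⟦⟧ (s ∩ᶠ t) σ x =
  trans (lookup-zipWith _∧_ x (⟦ s ⟧ σ) (⟦ t ⟧ σ)) (cong₂ _∧_ (lookup-⟦⟧ s σ x) (lookup-⟦⟧ t σ x))
lookup-⟦⟧ (s ─ᶠ t) σ x =
  trans (lookup-─ (⟦ s ⟧ σ) (⟦ t ⟧ σ) x)
        (cong₂ (λ a b → a ∧ not b) (lookup-⟦⟧ s σ x) (lookup-⟦⟧ t σ x))

Inclusion : ℕ → Set
Inclusion k = SetExpr k × SetExpr k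

_⇒ᵇ_ : Bool → Bool → Bool
true  ⇒ᵇ b = b
false ⇒ᵇ b = true

⇒ᵇ-intro : ∀ {a b} → (T a → T b) → T (a ⇒ᵇ b)
⇒ᵇ-intro {true}  f = f tt
⇒ᵇ-intro {false} f = tt

⇒ᵇ-elim : ∀ {a b} → T (a ⇒ᵇ b) → T a → T b
⇒ᵇ-elim {true} h _ = h

holdsᵇ : ∀ {k} → List (Inclusion k) → Vec Bool k → Bool
holdsᵇ []             β = true
holdsᵇ ((s , t) ∷ hs) β = (⟦ s ⟧ᵇ β ⇒ᵇ ⟦ t ⟧ᵇ β) ∧ holdsᵇ hs β

Holds : ∀ {k n} → Vec (Subset n) k → List (Inclusion k) → Set
Holds σ []             = Unit
Holds σ ((s , t) ∷ hs) = ⟦ s ⟧ σ ⊆ ⟦ t ⟧ σ × Holds σ hs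

everyValuation : ∀ k → (Vec Bool k → Bool) → Bool
everyValuation zero    P = P []
everyValuation (suc k) P = everyValuation k (P ∘ (true ∷_)) ∧ everyValuation k (P ∘ (false ∷_))

everyValuation-sound : ∀ k P → T (everyValuation k P) → ∀ β → T (P β)
everyValuation-sound zero    P h []          = h
everyValuation-sound (suc k) P h (true  ∷ β) =
  everyValuation-sound k _ (proj₁ (Equivalence.to T-∧ h)) β
everyValuation-sound (suc k) P h (false ∷ β) =
  everyValuation-sound k _ (proj₂ (Equivalence.to T-∧ h)) β

Valid : ∀ {k} → List (Inclusion k) → Inclusion k → Bool
Valid {k} hs (s , t) = everyValuation k λ β → holdsᵇ hs β ⇒ᵇ (⟦ s ⟧ᵇ β ⇒ᵇ ⟦ t ⟧ᵇ β)

module _ {k n : ℕ} (σ : Vec (Subset n) k) where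

  private
    valuation : Fin n → Vec Bool k
    valuation x = map (λ p → lookup p x) σ

    ∈⇒T : ∀ s {x} → x ∈ ⟦ s ⟧ σ → T (⟦ s ⟧ᵇ (valuation x))
    ∈⇒T s {x} x∈s =
      subst T (lookup-⟦⟧ s σ x) (Equivalence.from T-≡ ([]=⇒lookup x∈s))

    T⇒∈ : ∀ s {x} → T (⟦ s ⟧ᵇ (valuation x)) → x ∈ ⟦ s ⟧ σ
    T⇒∈ s {x} h =
      lookup⇒[]= x (⟦ s ⟧ σ) (Equivalence.to T-≡ (subst T (sym (lookup-⟦⟧ s σ x)) h))

    holdsᵇ-sound : ∀ hs → Holds σ hs → ∀ x → T (holdsᵇ hs (valuation x))
    holdsᵇ-sound []             _          x = tt
    holdsᵇ-sound ((s , t) ∷ hs) (s⊆t , h) x =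
      Equivalence.from T-∧
        (⇒ᵇ-intro (∈⇒T t ∘ s⊆t ∘ T⇒∈ s) , holdsᵇ-sound hs h x)

  -- The implicit validity proof is found by evaluation whenever the truth table checks out.
  ⊆-by-truth-table : ∀ hs s t → {T (Valid hs (s , t))} → Holds σ hs → ⟦ s ⟧ σ ⊆ ⟦ t ⟧ σ
  ⊆-by-truth-table hs s t {valid} h {x} x∈s =
    T⇒∈ t (⇒ᵇ-elim (⇒ᵇ-elim (everyValuation-sound k _ valid (valuation x)) (holdsᵇ-sound hs h x))
                   (∈⇒T s x∈s))

  ≡-by-truth-table : ∀ hs s t → {T (Valid hs (s , t))} → {T (Valid hs (t , s))} →
                     Holds σ hs → ⟦ s ⟧ σ ≡ ⟦ t ⟧ σ
  ≡-by-truth-table hs s t {st} {ts} h =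
    ⊆-antisym (⊆-by-truth-table hs s t {st} h) (⊆-by-truth-table hs t s {ts} h)

p⊆q∪p─q : ∀ {n} (p q : Subset n) → p ⊆ q ∪ (p ─ q)
p⊆q∪p─q p q = ⊆-by-truth-table (p ∷ q ∷ []) [] x₀ (x₁ ∪ᶠ (x₀ ─ᶠ x₁)) tt

q─[q─p]≡p : ∀ {n} {p q : Subset n} → p ⊆ q → q ─ (q ─ p) ≡ p
q─[q─p]≡p {p = p} {q} p⊆q = ≡-by-truth-table (p ∷ q ∷ []) ((x₀ , x₁) ∷ []) (x₁ ─ᶠ (x₁ ─ᶠ x₀)) x₀ (p⊆q , tt)

partition-⊥ : ∀ {n} (p : Subset n) → IsPartition p p ⊥
partition-⊥ p = ∪-identityʳ p , ∩-zeroʳ p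

partition-∩ : ∀ {n} {p q : Subset n} (s : Subset n) → p ⊆ q → IsPartition p (p ∩ s) (p ∩ (q ─ s))
partition-∩ {n} {p} {q} s p⊆q =
  ≡-by-truth-table σ hyp ((x₀ ∩ᶠ x₂) ∪ᶠ (x₀ ∩ᶠ (x₁ ─ᶠ x₂))) x₀ (p⊆q , tt) ,
  ≡-by-truth-table σ hyp ((x₀ ∩ᶠ x₂) ∩ᶠ (x₀ ∩ᶠ (x₁ ─ᶠ x₂))) ⊥ᶠ (p⊆q , tt)
  where
  σ : Vec (Subset n) 3
  σ = p ∷ q ∷ s ∷ []
  hyp : List (Inclusion 3)
  hyp = (x₀ , x₁) ∷ []

partition-∩′ : ∀ {n} {p q : Subset n} (s : Subset n) → p ⊆ q → IsPartition p (s ∩ p) ((q ─ s) ∩ p)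
partition-∩′ {n} {p} {q} s p⊆q =
  ≡-by-truth-table σ hyp ((x₂ ∩ᶠ x₀) ∪ᶠ ((x₁ ─ᶠ x₂) ∩ᶠ x₀)) x₀ (p⊆q , tt) ,
  ≡-by-truth-table σ hyp ((x₂ ∩ᶠ x₀) ∩ᶠ ((x₁ ─ᶠ x₂) ∩ᶠ x₀)) ⊥ᶠ (p⊆q , tt)
  where
  σ : Vec (Subset n) 3
  σ = p ∷ q ∷ s ∷ []
  hyp : List (Inclusion 3)
  hyp = (x₀ , x₁) ∷ []

module _ {n : ℕ} (N : Matroid n) where

  r-⊥ : r N ⊥ ≡ 0
  r-⊥ = n≤0⇒n≡0 (subst (r N ⊥ ≤_) (∣⊥∣≡0 n) (r-bounded N ⊥))

  r-⁅⁆≤1 : ∀ x → r N ⁅ x ⁆ ≤ 1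
  r-⁅⁆≤1 x = subst (r N ⁅ x ⁆ ≤_) (∣⁅x⁆∣≡1 x) (r-bounded N ⁅ x ⁆)

  r-submod-⊆ : ∀ {X Y Z W} → Z ⊆ X ∪ Y → W ⊆ X ∩ Y → r N Z + r N W ≤ r N X + r N Y
  r-submod-⊆ {X} {Y} Z⊆ W⊆ = ≤-trans (+-mono-≤ (r-mono N Z⊆) (r-mono N W⊆)) (r-submod N X Y)

  r-subadditive : ∀ {X Y Z} → Z ⊆ X ∪ Y → r N Z ≤ r N X + r N Y
  r-subadditive {X} {Y} Z⊆ = ≤-trans (r-mono N Z⊆) (≤-trans (m≤m+n _ _) (r-submod N X Y))

  Spans : Subset n → Fin n → Set
  Spans X x = r N (X ∪ ⁅ x ⁆) ≤ r N X

  spans? : ∀ X x → Dec (Spans X x)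
  spans? X x = r N (X ∪ ⁅ x ⁆) ≤? r N X

  spans-mono : ∀ {W Z} x → W ⊆ Z → Spans W x → Spans Z x
  spans-mono {W} {Z} x W⊆Z W-spans = +-cancelʳ-≤ (r N W) _ _ (begin
    r N (Z ∪ ⁅ x ⁆) + r N W          ≤⟨ r-submod-⊆ (⊆-by-truth-table σ hyp (x₁ ∪ᶠ x₂) (x₁ ∪ᶠ (x₀ ∪ᶠ x₂)) (W⊆Z , tt))
                                                  (⊆-by-truth-table σ hyp x₀ (x₁ ∩ᶠ (x₀ ∪ᶠ x₂)) (W⊆Z , tt)) ⟩
    r N Z + r N (W ∪ ⁅ x ⁆)          ≤⟨ +-monoʳ-≤ (r N Z) W-spans ⟩
    r N Z + r N W                    ∎)
    where
    open ≤-Reasoning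
    σ : Vec (Subset n) 3
    σ = W ∷ Z ∷ ⁅ x ⁆ ∷ []
    hyp : List (Inclusion 3)
    hyp = (x₀ , x₁) ∷ []

module _ {n : ℕ} (N : Matroid n) where

  connectivity-+ : ∀ E X → connectivity E (r N) X + r N E ≡ r N X + r N (E ─ X) + 1
  connectivity-+ E X = m∸n+n≡m (≤-trans (r-subadditive N (p⊆q∪p─q E X)) (m≤m+n _ 1))

  1≤connectivity : ∀ E X → 1 ≤ connectivity E (r N) X
  1≤connectivity E X = +-cancelʳ-≤ (r N E) 1 _ (begin
    1 + r N E                           ≡⟨ +-comm 1 (r N E) ⟩
    r N E + 1                           ≤⟨ +-monoˡ-≤ 1 (r-subadditive N (p⊆q∪p─q E X)) ⟩
    r N X + r N (E ─ X) + 1             ≡⟨ connectivity-+ E X ⟨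
    connectivity E (r N) X + r N E      ∎)
    where
    open ≤-Reasoning

  connectivity-⊥ : ∀ E → connectivity E (r N) ⊥ ≡ 1
  connectivity-⊥ E rewrite r-⊥ N | p─⊥≡p E = m+n∸m≡n (r N E) 1

  connectivity-complement : ∀ {E X} → X ⊆ E → connectivity E (r N) (E ─ X) ≡ connectivity E (r N) X
  connectivity-complement {E} {X} X⊆E rewrite q─[q─p]≡p X⊆E =
    cong (λ m → m + 1 ∸ r N E) (+-comm (r N (E ─ X)) (r N X))

  connectivity-restrict : ∀ {E F X} → X ⊆ E → E ⊆ F → connectivity E (r N) X ≤ connectivity F (r N) X
  connectivity-restrict {E} {F} {X} X⊆E E⊆F = +-cancelʳ-≤ (r N E + r N F) _ _ (begin
    connectivity E (r N) X + (r N E + r N F)    ≡⟨ +-assoc (connectivity E (r N) X) _ _ ⟨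
    connectivity E (r N) X + r N E + r N F      ≡⟨ cong (_+ r N F) (connectivity-+ E X) ⟩
    r N X + r N (E ─ X) + 1 + r N F             ≤⟨ shift-≤ (r N X) submod ⟩
    r N X + r N (F ─ X) + 1 + r N E             ≡⟨ cong (_+ r N E) (connectivity-+ F X) ⟨
    connectivity F (r N) X + r N F + r N E      ≡⟨ +-assoc (connectivity F (r N) X) _ _ ⟩
    connectivity F (r N) X + (r N F + r N E)    ≡⟨ cong (connectivity F (r N) X +_) (+-comm (r N F) _) ⟩
    connectivity F (r N) X + (r N E + r N F)    ∎)
    where
    open ≤-Reasoning
    submod : r N F + r N (E ─ X) ≤ r N E + r N (F ─ X)
    submod = r-submod-⊆ N
      (⊆-by-truth-table (X ∷ E ∷ F ∷ []) ((x₀ , x₁) ∷ []) x₂ (x₁ ∪ᶠ (x₂ ─ᶠ x₀)) (X⊆E , tt))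
      (⊆-by-truth-table (X ∷ E ∷ F ∷ []) ((x₁ , x₂) ∷ []) (x₁ ─ᶠ x₀) (x₁ ∩ᶠ (x₂ ─ᶠ x₀)) (E⊆F , tt))
    shift-≤ : ∀ a {b c d e} → d + b ≤ e + c → a + b + 1 + d ≤ a + c + 1 + e
    shift-≤ a {b} {c} {d} {e} h = begin
      a + b + 1 + d      ≡⟨ shape a b d ⟩
      a + 1 + (d + b)    ≤⟨ +-monoʳ-≤ (a + 1) h ⟩
      a + 1 + (e + c)    ≡⟨ shape a c e ⟨
      a + c + 1 + e      ∎
      where
      shape : ∀ a b d → a + b + 1 + d ≡ a + 1 + (d + b)
      shape = solve-∀

contractRank-+ : ∀ {n} (M : Matroid n) e X → contractRank M e X + r M ⁅ e ⁆ ≡ r M (X ∪ ⁅ e ⁆)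
contractRank-+ M e X = m∸n+n≡m (r-mono M (q⊆p∪q X ⁅ e ⁆))

infixl 8 _／_

_／_ : ∀ {n} → Matroid n → Fin n → Matroid n
_／_ {n} M e = record
  { r         = rc
  ; r-bounded = λ X → begin
      rc X                         ≤⟨ ∸-monoˡ-≤ (r M ε) (r-subadditive M ⊆-refl) ⟩
      r M X + r M ε ∸ r M ε        ≡⟨ m+n∸n≡m (r M X) (r M ε) ⟩
      r M X                        ≤⟨ r-bounded M X ⟩
      ∣ X ∣                        ∎
  ; r-mono    = λ {X} {Y} X⊆Y → ∸-monoˡ-≤ (r M ε)
      (r-mono M (⊆-by-truth-table (X ∷ Y ∷ ε ∷ []) ((x₀ , x₁) ∷ []) (x₀ ∪ᶠ x₂) (x₁ ∪ᶠ x₂) (X⊆Y , tt)))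
  ; r-submod  = submod
  }
  where
  open ≤-Reasoning
  ε : Subset n
  ε = ⁅ e ⁆
  rc : Subset n → ℕ
  rc = contractRank M e
  submod : ∀ X Y → rc (X ∪ Y) + rc (X ∩ Y) ≤ rc X + rc Y
  submod X Y = +-cancelʳ-≤ (r M ε + r M ε) _ _ (begin
    rc (X ∪ Y) + rc (X ∩ Y) + (r M ε + r M ε)       ≡⟨ interchange (rc (X ∪ Y)) (rc (X ∩ Y)) (r M ε) (r M ε) ⟩
    rc (X ∪ Y) + r M ε + (rc (X ∩ Y) + r M ε)       ≡⟨ cong₂ _+_ (contractRank-+ M e (X ∪ Y)) (contractRank-+ M e (X ∩ Y)) ⟩
    r M ((X ∪ Y) ∪ ε) + r M ((X ∩ Y) ∪ ε)           ≤⟨ r-submod-⊆ M (⊆-by-truth-table σ [] ((x₀ ∪ᶠ x₁) ∪ᶠ x₂) ((x₀ ∪ᶠ x₂) ∪ᶠ (x₁ ∪ᶠ x₂)) tt)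
                                                                    (⊆-by-truth-table σ [] ((x₀ ∩ᶠ x₁) ∪ᶠ x₂) ((x₀ ∪ᶠ x₂) ∩ᶠ (x₁ ∪ᶠ x₂)) tt) ⟩
    r M (X ∪ ε) + r M (Y ∪ ε)                       ≡⟨ cong₂ _+_ (contractRank-+ M e X) (contractRank-+ M e Y) ⟨
    rc X + r M ε + (rc Y + r M ε)                   ≡⟨ interchange (rc X) (r M ε) (rc Y) (r M ε) ⟩
    rc X + rc Y + (r M ε + r M ε)                   ∎)
    where
    σ : Vec (Subset n) 3
    σ = X ∷ Y ∷ ε ∷ []

Splittable : ∀ {n} → KPair n → KPair n → Subset n → Set
Splittable K₀ K A =
  ∃₂ λ X₁ X₂ → (IsPartition A X₁ X₂ ⊎ IsPartition (gnd K₀ ─ A) X₁ X₂) ×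
               (lam K X₁ ≤ lam K₀ A) × (lam K X₂ ≤ lam K₀ A)

isPartition? : ∀ {n} (A X₁ X₂ : Subset n) → Dec (IsPartition A X₁ X₂)
isPartition? A X₁ X₂ = ≡-dec _≟ᵇ_ (X₁ ∪ X₂) A ×-dec ≡-dec _≟ᵇ_ (X₁ ∩ X₂) ⊥

splittable? : ∀ {n} (K₀ K : KPair n) A → Dec (Splittable K₀ K A)
splittable? K₀ K A = anySubset? λ X₁ → anySubset? λ X₂ →
  (isPartition? A X₁ X₂ ⊎-dec isPartition? (gnd K₀ ─ A) X₁ X₂) ×-dec
  (lam K X₁ ≤? lam K₀ A) ×-dec (lam K X₂ ≤? lam K₀ A)

adheres-or-unsplittable : ∀ {n} (K₀ K : KPair n) → Dominates K K₀ →
                          Adheres K₀ K ⊎ ∃ λ A → A ⊆ gnd K₀ × ¬ Splittable K₀ K A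
adheres-or-unsplittable K₀ K dominates
  with anySubset? (λ A → (A ⊆? gnd K₀) ×-dec ¬? (splittable? K₀ K A))
... | yes unsplittable = inj₂ unsplittable
... | no  none         =
  inj₁ (dominates , λ A A⊆ → decidable-stable (splittable? K₀ K A) λ ¬split → none (A , A⊆ , ¬split))

-- A 2×2 grid of numbers

private
  one-exceeds : ∀ {x y K} → ¬ (x ≤ K × y ≤ K) → K < x ⊎ K < y
  one-exceeds {x} {y} {K} ¬both with x ≤? K | y ≤? K
  ... | yes x≤K | yes y≤K = contradiction (x≤K , y≤K) ¬both
  ... | no  x≰K | _       = inj₁ (≰⇒> x≰K)
  ... | yes _   | no  y≰K = inj₂ (≰⇒> y≰K)

  partner-≤ : ∀ {x y K L} → K < x → x + y ≤ K + L + 1 → y ≤ L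
  partner-≤ {x} {y} {K} {L} K<x x+y≤ = +-cancelˡ-≤ (suc K) y L (begin
    suc K + y     ≤⟨ +-monoˡ-≤ y K<x ⟩
    x + y         ≤⟨ x+y≤ ⟩
    K + L + 1     ≡⟨ shape K L ⟩
    suc K + L     ∎)
    where
    open ≤-Reasoning
    shape : ∀ K L → K + L + 1 ≡ 1 + K + L
    shape = solve-∀

  column-bounded-of-corner : ∀ {K L a b c d} → K < a → ¬ (c ≤ K × d ≤ K) →
    a + d ≤ K + L + 1 → b + c ≤ K + L + 1 → (a ≤ L × c ≤ L) ⊎ (b ≤ L × d ≤ L)
  column-bounded-of-corner {K} {L} {a} {b} {c} {d} K<a ¬row₂ ad bc with c ≤? K
  ... | no  c≰K = inj₂ (partner-≤ (≰⇒> c≰K) (subst (_≤ K + L + 1) (+-comm b c) bc) , partner-≤ K<a ad)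
  ... | yes c≤K = inj₁ (a≤L , ≤-trans c≤K (≤-trans (<⇒≤ K<d) (partner-≤ K<a ad)))
    where
    K<d : K < d
    K<d = ≰⇒> λ d≤K → ¬row₂ (c≤K , d≤K)
    a≤L : a ≤ L
    a≤L = partner-≤ K<d (subst (_≤ K + L + 1) (+-comm a d) ad)

-- The grid has rows a b and c d; rows are tested against K, columns against L.
column-bounded : ∀ {K L a b c d} → ¬ (a ≤ K × b ≤ K) → ¬ (c ≤ K × d ≤ K) →
  a + d ≤ K + L + 1 → b + c ≤ K + L + 1 → (a ≤ L × c ≤ L) ⊎ (b ≤ L × d ≤ L)
column-bounded ¬row₁ ¬row₂ ad bc with one-exceeds ¬row₁
... | inj₁ K<a = column-bounded-of-corner K<a ¬row₂ ad bc
... | inj₂ K<b = swap (column-bounded-of-corner K<b (λ (d≤K , c≤K) → ¬row₂ (c≤K , d≤K)) bc ad)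

module _ {n : ℕ} (M : Matroid n) (e : Fin n) where

  private
    ρ : Subset n → ℕ
    ρ = r M
    ε E₀ : Subset n
    ε  = ⁅ e ⁆
    E₀ = ⊤ ─ ε
    λM λD λC : Subset n → ℕ
    λM = connectivity ⊤ ρ
    λD = connectivity E₀ ρ
    λC = connectivity E₀ (r (M ／ e))

  -- Adding r(E) + r(e) to λ_M and λ_{M/e} clears every truncated subtraction in them.
  λM-+ : ∀ X → λM X + (ρ ⊤ + ρ ε) ≡ ρ X + ρ (⊤ ─ X) + 1 + ρ ε
  λM-+ X = trans (sym (+-assoc (λM X) (ρ ⊤) (ρ ε))) (cong (_+ ρ ε) (connectivity-+ M ⊤ X))

  λC-+ : ∀ X → λC X + (ρ ⊤ + ρ ε) ≡ ρ (X ∪ ε) + ρ ((E₀ ─ X) ∪ ε) + 1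
  λC-+ X = begin
    λC X + (ρ ⊤ + ρ ε)                                   ≡⟨ cong (λ m → λC X + (m + ρ ε)) contractRank-E₀ ⟨
    λC X + (rc E₀ + ρ ε + ρ ε)                           ≡⟨ shape₁ (λC X) (rc E₀) (ρ ε) ⟩
    λC X + rc E₀ + (ρ ε + ρ ε)                           ≡⟨ cong (_+ (ρ ε + ρ ε)) (connectivity-+ (M ／ e) E₀ X) ⟩
    rc X + rc (E₀ ─ X) + 1 + (ρ ε + ρ ε)                 ≡⟨ shape₂ (rc X) (rc (E₀ ─ X)) (ρ ε) ⟩
    rc X + ρ ε + (rc (E₀ ─ X) + ρ ε) + 1                 ≡⟨ cong₂ (λ a b → a + b + 1) (contractRank-+ M e X) (contractRank-+ M e (E₀ ─ X)) ⟩
    ρ (X ∪ ε) + ρ ((E₀ ─ X) ∪ ε) + 1                     ∎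
    where
    open ≡-Reasoning
    rc : Subset n → ℕ
    rc = contractRank M e
    contractRank-E₀ : rc E₀ + ρ ε ≡ ρ ⊤
    contractRank-E₀ = trans (contractRank-+ M e E₀)
      (≤-antisym (r-mono M ⊆⊤) (r-mono M (⊆-by-truth-table (ε ∷ []) [] ⊤ᶠ ((⊤ᶠ ─ᶠ x₀) ∪ᶠ x₀) tt)))
    shape₁ : ∀ l c d → l + (c + d + d) ≡ l + c + (d + d)
    shape₁ = solve-∀
    shape₂ : ∀ a b d → a + b + 1 + (d + d) ≡ a + d + (b + d) + 1
    shape₂ = solve-∀

  delete-dominates : Dominates (K M) (K-delete M e)
  delete-dominates = ⊆⊤ , λ X X⊆E₀ → connectivity-restrict M X⊆E₀ ⊆⊤

  contract-dominates : Dominates (K M) (K-contract M e)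
  contract-dominates = ⊆⊤ , λC≤λM
    where
    λC≤λM : ∀ X → X ⊆ E₀ → λC X ≤ λM X
    λC≤λM X X⊆E₀ = +-cancelʳ-≤ (ρ ⊤ + ρ ε) _ _ (begin
      λC X + (ρ ⊤ + ρ ε)                   ≡⟨ λC-+ X ⟩
      ρ (X ∪ ε) + ρ ((E₀ ─ X) ∪ ε) + 1     ≤⟨ +-monoˡ-≤ 1 (+-mono-≤ (r-subadditive M ⊆-refl) (r-mono M cover)) ⟩
      ρ X + ρ ε + ρ (⊤ ─ X) + 1            ≡⟨ shape (ρ X) (ρ ε) (ρ (⊤ ─ X)) ⟩
      ρ X + ρ (⊤ ─ X) + 1 + ρ ε            ≡⟨ λM-+ X ⟨
      λM X + (ρ ⊤ + ρ ε)                   ∎)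
      where
      open ≤-Reasoning
      cover : (E₀ ─ X) ∪ ε ⊆ ⊤ ─ X
      cover = ⊆-by-truth-table (X ∷ ε ∷ []) ((x₀ , ⊤ᶠ ─ᶠ x₁) ∷ [])
                (((⊤ᶠ ─ᶠ x₁) ─ᶠ x₀) ∪ᶠ x₁) (⊤ᶠ ─ᶠ x₀) (X⊆E₀ , tt)
      shape : ∀ a d b → a + d + b + 1 ≡ a + b + 1 + d
      shape = solve-∀

  λM⊥≤λC : ∀ X → λM ⊥ ≤ λC X
  λM⊥≤λC X = subst (_≤ λC X) (sym (connectivity-⊥ M ⊤)) (1≤connectivity (M ／ e) E₀ X)

  ¬spans⇒λM≤λC : ∀ {X} → ¬ Spans M X e → λM X ≤ λC X
  ¬spans⇒λM≤λC {X} ¬spans = +-cancelʳ-≤ (ρ ⊤ + ρ ε) _ _ (begin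
    λM X + (ρ ⊤ + ρ ε)                   ≡⟨ λM-+ X ⟩
    ρ X + ρ (⊤ ─ X) + 1 + ρ ε            ≤⟨ +-monoʳ-≤ _ (r-⁅⁆≤1 M e) ⟩
    ρ X + ρ (⊤ ─ X) + 1 + 1              ≡⟨ shape (ρ X) (ρ (⊤ ─ X)) ⟩
    1 + ρ X + ρ (⊤ ─ X) + 1              ≤⟨ +-monoˡ-≤ 1 (+-mono-≤ (≰⇒> ¬spans) (r-mono M cover)) ⟩
    ρ (X ∪ ε) + ρ ((E₀ ─ X) ∪ ε) + 1     ≡⟨ λC-+ X ⟨
    λC X + (ρ ⊤ + ρ ε)                   ∎)
    where
    open ≤-Reasoning
    cover : ⊤ ─ X ⊆ (E₀ ─ X) ∪ ε
    cover = ⊆-by-truth-table (X ∷ ε ∷ []) [] (⊤ᶠ ─ᶠ x₀) (((⊤ᶠ ─ᶠ x₁) ─ᶠ x₀) ∪ᶠ x₁) tt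
    shape : ∀ a b → a + b + 1 + 1 ≡ 1 + a + b + 1
    shape = solve-∀

  λD-≥ : ∀ X → ρ X + ρ (E₀ ─ X) + 1 ≤ λD X + ρ ⊤
  λD-≥ X = subst (_≤ λD X + ρ ⊤) (connectivity-+ M E₀ X) (+-monoʳ-≤ (λD X) (r-mono M ⊆⊤))

  λC-≥ : ∀ X → ρ X + ρ (E₀ ─ X) ≤ λC X + ρ ⊤
  λC-≥ X = +-cancelʳ-≤ (ρ ε) _ _ (begin
    ρ X + ρ (E₀ ─ X) + ρ ε                ≤⟨ +-monoʳ-≤ _ (r-⁅⁆≤1 M e) ⟩
    ρ X + ρ (E₀ ─ X) + 1                  ≤⟨ +-monoˡ-≤ 1 (+-mono-≤ (r-mono M (p⊆p∪q ε)) (r-mono M (p⊆p∪q ε))) ⟩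
    ρ (X ∪ ε) + ρ ((E₀ ─ X) ∪ ε) + 1      ≡⟨ λC-+ X ⟨
    λC X + (ρ ⊤ + ρ ε)                    ≡⟨ +-assoc (λC X) (ρ ⊤) (ρ ε) ⟨
    λC X + ρ ⊤ + ρ ε                      ∎)
    where open ≤-Reasoning

  λM-≤-of-cover : ∀ {X Y} → Spans M Y e → ⊤ ─ X ⊆ Y ∪ ε → λM X + ρ ⊤ ≤ ρ X + ρ Y + 1
  λM-≤-of-cover {X} {Y} Y-spans cover = begin
    λM X + ρ ⊤                 ≡⟨ connectivity-+ M ⊤ X ⟩
    ρ X + ρ (⊤ ─ X) + 1        ≤⟨ +-monoˡ-≤ 1 (+-monoʳ-≤ (ρ X) (≤-trans (r-mono M cover) Y-spans)) ⟩
    ρ X + ρ Y + 1              ∎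
    where open ≤-Reasoning

  diagonal-≤ : ∀ A C → Spans M C e → Spans M (E₀ ─ C) e →
               λM (A ∩ C) + λM ((E₀ ─ A) ∩ (E₀ ─ C)) ≤ λD A + λC C + 1
  diagonal-≤ A C C-spans D-spans = +-cancelʳ-≤ (ρ ⊤ + ρ ⊤) _ _ (begin
    λM (A ∩ C) + λM (B ∩ D) + (ρ ⊤ + ρ ⊤)              ≡⟨ interchange (λM (A ∩ C)) (λM (B ∩ D)) (ρ ⊤) (ρ ⊤) ⟩
    λM (A ∩ C) + ρ ⊤ + (λM (B ∩ D) + ρ ⊤)              ≤⟨ +-mono-≤ (λM-≤-of-cover (spans-mono M e (q⊆p∪q B D) D-spans) cover-AC)
                                                                   (λM-≤-of-cover (spans-mono M e (q⊆p∪q A C) C-spans) cover-BD) ⟩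
    ρ (A ∩ C) + ρ (B ∪ D) + 1 + (ρ (B ∩ D) + ρ (A ∪ C) + 1)
                                                        ≡⟨ shape₁ (ρ (A ∩ C)) (ρ (B ∪ D)) (ρ (B ∩ D)) (ρ (A ∪ C)) ⟩
    ρ (A ∪ C) + ρ (A ∩ C) + (ρ (B ∪ D) + ρ (B ∩ D)) + 2
                                                        ≤⟨ +-monoˡ-≤ 2 (+-mono-≤ (r-submod M A C) (r-submod M B D)) ⟩
    ρ A + ρ C + (ρ B + ρ D) + 2                         ≡⟨ shape₂ (ρ A) (ρ C) (ρ B) (ρ D) ⟩
    ρ A + ρ B + 1 + (ρ C + ρ D) + 1                     ≤⟨ +-monoˡ-≤ 1 (+-mono-≤ (λD-≥ A) (λC-≥ C)) ⟩
    λD A + ρ ⊤ + (λC C + ρ ⊤) + 1                       ≡⟨ shape₃ (λD A) (λC C) (ρ ⊤) ⟩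
    λD A + λC C + 1 + (ρ ⊤ + ρ ⊤)                       ∎)
    where
    open ≤-Reasoning
    B D : Subset n
    B = E₀ ─ A
    D = E₀ ─ C
    σ : Vec (Subset n) 3
    σ = A ∷ C ∷ ε ∷ []
    cover-AC : ⊤ ─ (A ∩ C) ⊆ (B ∪ D) ∪ ε
    cover-AC = ⊆-by-truth-table σ [] (⊤ᶠ ─ᶠ (x₀ ∩ᶠ x₁)) ((((⊤ᶠ ─ᶠ x₂) ─ᶠ x₀) ∪ᶠ ((⊤ᶠ ─ᶠ x₂) ─ᶠ x₁)) ∪ᶠ x₂) tt
    cover-BD : ⊤ ─ (B ∩ D) ⊆ (A ∪ C) ∪ ε
    cover-BD = ⊆-by-truth-table σ [] (⊤ᶠ ─ᶠ (((⊤ᶠ ─ᶠ x₂) ─ᶠ x₀) ∩ᶠ ((⊤ᶠ ─ᶠ x₂) ─ᶠ x₁))) ((x₀ ∪ᶠ x₁) ∪ᶠ x₂) tt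
    shape₁ : ∀ p q s t → p + q + 1 + (s + t + 1) ≡ t + p + (q + s) + 2
    shape₁ = solve-∀
    shape₂ : ∀ a c b d → a + c + (b + d) + 2 ≡ a + b + 1 + (c + d) + 1
    shape₂ = solve-∀
    shape₃ : ∀ k l t → k + t + (l + t) + 1 ≡ k + l + 1 + (t + t)
    shape₃ = solve-∀

  contract-splittable : ∀ {A} → A ⊆ E₀ → ¬ Splittable (K-delete M e) (K M) A →
                        ∀ C → C ⊆ E₀ → Splittable (K-contract M e) (K M) C
  contract-splittable {A} A⊆E₀ A-unsplittable C C⊆E₀ with spans? M C e | spans? M (E₀ ─ C) e
  ... | no ¬C-spans | _ = C , ⊥ , inj₁ (partition-⊥ C) , ¬spans⇒λM≤λC ¬C-spans , λM⊥≤λC C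
  ... | yes _ | no ¬D-spans =
    D , ⊥ , inj₂ (partition-⊥ D) ,
    subst (λM D ≤_) (connectivity-complement (M ／ e) C⊆E₀) (¬spans⇒λM≤λC ¬D-spans) , λM⊥≤λC C
    where
    D : Subset n
    D = E₀ ─ C
  ... | yes C-spans | yes D-spans =
    [ column-C , column-D ] (column-bounded row-A row-B diagonal-AC diagonal-AD)
    where
    B D : Subset n
    B = E₀ ─ A
    D = E₀ ─ C
    row-A : ¬ (λM (A ∩ C) ≤ λD A × λM (A ∩ D) ≤ λD A)
    row-A (≤₁ , ≤₂) = A-unsplittable (A ∩ C , A ∩ D , inj₁ (partition-∩ C A⊆E₀) , ≤₁ , ≤₂)
    row-B : ¬ (λM (B ∩ C) ≤ λD A × λM (B ∩ D) ≤ λD A)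
    row-B (≤₁ , ≤₂) = A-unsplittable (B ∩ C , B ∩ D , inj₂ (partition-∩ C (p─q⊆p E₀ A)) , ≤₁ , ≤₂)
    diagonal-AC : λM (A ∩ C) + λM (B ∩ D) ≤ λD A + λC C + 1
    diagonal-AC = diagonal-≤ A C C-spans D-spans
    diagonal-AD : λM (A ∩ D) + λM (B ∩ C) ≤ λD A + λC C + 1
    diagonal-AD = subst₂ (λ Y l → λM (A ∩ D) + λM (B ∩ Y) ≤ λD A + l + 1)
      (q─[q─p]≡p C⊆E₀) (connectivity-complement (M ／ e) C⊆E₀)
      (diagonal-≤ A D D-spans (subst (λ Y → Spans M Y e) (sym (q─[q─p]≡p C⊆E₀)) C-spans))
    column-C : λM (A ∩ C) ≤ λC C × λM (B ∩ C) ≤ λC C → Splittable (K-contract M e) (K M) C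
    column-C (≤₁ , ≤₂) = A ∩ C , B ∩ C , inj₁ (partition-∩′ A C⊆E₀) , ≤₁ , ≤₂
    column-D : λM (A ∩ D) ≤ λC C × λM (B ∩ D) ≤ λC C → Splittable (K-contract M e) (K M) C
    column-D (≤₁ , ≤₂) = A ∩ D , B ∩ D , inj₂ (partition-∩′ A (p─q⊆p E₀ C)) , ≤₁ , ≤₂

lemma3p2 : ∀ {n} (M : Matroid n) (e : Fin n) →
    Adheres (K-delete M e) (K M) ⊎ Adheres (K-contract M e) (K M)
lemma3p2 M e with adheres-or-unsplittable (K-delete M e) (K M) (delete-dominates M e)
... | inj₁ delete-adheres                  = inj₁ delete-adheres
... | inj₂ (A , A⊆E₀ , A-unsplittable) =
  inj₂ (contract-dominates M e , contract-splittable M e A⊆E₀ A-unsplittable)
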